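{- $R^f_\Box$ is an equivalence relation.
   Context: Let $\mathcal{M}^c = (S^c, R^c_\Box, \{R^c_{[i]}, R^c_{\mathsf{O}_i}\}, R^c_{\mathsf{Agt}}, \to^c, V^c)$ be the canonical model of the logic $\mathsf{L}_{\mathrm{DTDS}}$: $S^c$ is the set of maximally consistent sets (MCSs), and $wR^c_\Box v$ iff $\varphi\in v$ whenever $\Box\varphi\in w$ (similarly for the other operators). Since $\mathsf{L}_{\mathrm{DTDS}}$ contains the $\mathsf{S5}$ axioms for $\Box$, $R^c_\Box$ is an equivalence relation. Fix a finite set $\Sigma$ of formulas that is filtration-ready (closed under subformulas, under non-redundant negation, contains $\mathsf{X}\mathsf{U}(\alpha,\beta)$ whenever it contains $\mathsf{U}(\alpha,\beta)$, and contains $[i]\varphi$ whenever it contains $\mathsf{O}_i\varphi$). For an MCS $w$ let $\Sigma(w)=w\cap\Sigma$, and define the equivalence relation $\sim$ on $S^c$ by $w\sim v$ iff $\Sigma(w)=\Sigma(v)$ and $\{\Sigma(x)\mid wR^c_\Box x\}=\{\Sigma(x)\mid vR^c_\Box x\}$. $S^f$ is the set of $\sim$-equivalence classes, and $R^f_\Box$ is the existential lifting of $R^c_\Box$: for $C,D\in S^f$, $CR^f_\Box D$ iff there are $w\in C$, $v\in D$ with $wR^c_\Box v$. It has been shown that ${\sim}\circ R^c_\Box = R^c_\Box\circ{\sim}$ (relational composition). -}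

module Defs where

open import Data.Product using (Σ; _×_; _,_; ∃-syntax)
open import Relation.Binary.PropositionalEquality using (_≡_)

-- S     : the carrier S^c (the maximally consistent sets)
--   R     : the relation R^c_□ (an equivalence, by S5)
--   X     : the type of subsets of the finite set Σ of formulas
--   sig   : w ↦ Σ(w) = w ∩ Σ
module Filtration {S X : Set} (R : S → S → Set) (sig : S → X) where

  SigSetIncl : S → S → Set
  SigSetIncl w v = ∀ x → R w x → ∃[ y ] (R v y × sig x ≡ sig y)

  _∼_ : S → S → Set
  w ∼ v = (sig w ≡ sig v) × SigSetIncl w v × SigSetIncl v w

  -- Existential lifting R^f_□ of R to ∼-classes, expressed on representatives:
  -- [c] R^f [d] iff there are w ∼ c, v ∼ d with w R v.
  Rf : S → S → Set
  Rf c d = ∃[ w ] ∃[ v ] (w ∼ c × v ∼ d × R w v)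

{-# OPTIONS --safe #-}
module Submission where

open import Defs
open import Data.Product using (_,_; ∃-syntax; _×_)
open import Relation.Binary.Structures using (IsEquivalence)
import Relation.Binary.PropositionalEquality as ≡

-- For transitivity, the ∼-step
-- in the middle of w R v ∼ w′ R v′ is pushed past R (∼ ∘ R ⊆ R ∘ ∼): since R
-- is an equivalence, R-related worlds see the same Σ-sets, so the y with
-- v R y and Σ(y) = Σ(v′) given by v ∼ w′ satisfies y ∼ v′.

module FiltrationProperties {S X : Set} (R : S → S → Set) (sig : S → X) where
  open Filtration R sig

  SigSetIncl-refl : ∀ w → SigSetIncl w w
  SigSetIncl-refl w x wRx = x , wRx , ≡.refl

  SigSetIncl-trans : ∀ {u v w} → SigSetIncl u v → SigSetIncl v w → SigSetIncl u w
  SigSetIncl-trans u⊆v v⊆w x uRx with u⊆v x uRx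
  ... | y , vRy , x≡y with v⊆w y vRy
  ...   | z , wRz , y≡z = z , wRz , ≡.trans x≡y y≡z

  ∼-refl : ∀ w → w ∼ w
  ∼-refl w = ≡.refl , SigSetIncl-refl w , SigSetIncl-refl w

  ∼-sym : ∀ {v w} → v ∼ w → w ∼ v
  ∼-sym (v≡w , v⊆w , w⊆v) = ≡.sym v≡w , w⊆v , v⊆w

  ∼-trans : ∀ {u v w} → u ∼ v → v ∼ w → u ∼ w
  ∼-trans (u≡v , u⊆v , v⊆u) (v≡w , v⊆w , w⊆v) =
    ≡.trans u≡v v≡w , SigSetIncl-trans u⊆v v⊆w , SigSetIncl-trans w⊆v v⊆u

  module _ (R-isEquivalence : IsEquivalence R) where
    open IsEquivalence R-isEquivalence
      renaming (refl to R-refl; sym to R-sym; trans to R-trans)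

    R⇒SigSetIncl : ∀ {v w} → R v w → SigSetIncl v w
    R⇒SigSetIncl vRw x vRx = x , R-trans (R-sym vRw) vRx , ≡.refl

    ∼-R-commute : ∀ {v w u} → v ∼ w → R w u → ∃[ y ] (R v y × y ∼ u)
    ∼-R-commute (_ , v⊆w , w⊆v) wRu with w⊆v _ wRu
    ... | y , vRy , u≡y =
      y , vRy , ≡.sym u≡y , y⊆u , u⊆y
      where
      y⊆u : SigSetIncl y _
      y⊆u = SigSetIncl-trans (R⇒SigSetIncl (R-sym vRy))
              (SigSetIncl-trans v⊆w (R⇒SigSetIncl wRu))

      u⊆y : SigSetIncl _ y
      u⊆y = SigSetIncl-trans (R⇒SigSetIncl (R-sym wRu))
              (SigSetIncl-trans w⊆v (R⇒SigSetIncl vRy))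

    Rf-refl : ∀ c → Rf c c
    Rf-refl c = c , c , ∼-refl c , ∼-refl c , R-refl

    Rf-sym : ∀ {c d} → Rf c d → Rf d c
    Rf-sym (w , v , w∼c , v∼d , wRv) = v , w , v∼d , w∼c , R-sym wRv

    Rf-trans : ∀ {c d e} → Rf c d → Rf d e → Rf c e
    Rf-trans (w , v , w∼c , v∼d , wRv) (w′ , v′ , w′∼d , v′∼e , w′Rv′)
      with ∼-R-commute (∼-trans v∼d (∼-sym w′∼d)) w′Rv′
    ... | y , vRy , y∼v′ = w , y , w∼c , ∼-trans y∼v′ v′∼e , R-trans wRv vRy

    Rf-isEquivalence : IsEquivalence Rf
    Rf-isEquivalence = record
      { refl  = λ {c} → Rf-refl c
      ; sym   = Rf-sym
      ; trans = Rf-trans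
      }

proposition10 : {S X : Set} (R : S → S → Set) (sig : S → X) →
    IsEquivalence R →
    IsEquivalence (Filtration.Rf R sig)
proposition10 R sig R-isEquivalence =
  FiltrationProperties.Rf-isEquivalence R sig R-isEquivalence
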